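{- Let $G$ be a finite reflexive graph, and suppose that an edge $vv'$ of $G$ avoids a walk $u_0u_1\dots u_t$ with $t\ge 1$. Then: (1) If neither $\{u_0,u_1,v,v'\}$ nor $\{u_{t-1},u_t,v,v'\}$ induces a $C_4$, then for any $x\in\{v,v'\}$ and $y\in\{v,v'\}$, $(u_0,x)\sim(u_t,y)$. (2) If $\{u_0,u_1,v,v'\}$ induces a $C_4$ and $\{u_{t-1},u_t,v,v'\}$ does not, then for any $y\in\{v,v'\}$, $(u_0,x)\sim(u_t,y)$, where $x$ is the unique vertex of $\{v,v'\}$ with $u_0x\in E(G)$. (3) If both $\{u_0,u_1,v,v'\}$ and $\{u_{t-1},u_t,v,v'\}$ induce a $C_4$, then $(u_0,x)\sim(u_t,y)$, where $x$ is the unique vertex of $\{v,v'\}$ with $u_0x\in E(G)$ and $y$ is the unique vertex of $\{v,v'\}$ with $u_ty\in E(G)$.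
   Context: A reflexive graph has a loop at every vertex; $E(G)$ includes all loops. A walk is a sequence of vertices $w_0\dots w_t$ with $w_jw_{j+1}\in E(G)$ (consecutive vertices may coincide); its edges are the $w_jw_{j+1}$. For edges $uu',vv'$ (possibly loops) with $\{u,u'\}\cap\{v,v'\}=\emptyset$, $uu'$ avoids $vv'$ if: (i) $u=u'$, $v=v'$, $uv\notin E(G)$; or (ii) $u=u'$, $v\neq v'$, $uv,uv'\notin E(G)$; or (iii) $u\ne u'$, $v=v'$, $uv,u'v\notin E(G)$; or (iv) $u\ne u'$, $v\ne v'$ and $\{u,u',v,v'\}$ induces $2K_2$, $P_4$ or $C_4$. An edge avoids a walk if it avoids every edge of the walk. Let $Z(G)$ be the set of ordered pairs of distinct vertices. For $(u,v),(u',v')\in Z(G)$, $(u,v)$ forces $(u',v')$, written $(u,v)\Lambda(u',v')$, if either $u=u'$ and $v=v'$, or $uu',vv'\in E(G)$ and $uv',vu'\notin E(G)$. Write $(u,v)\sim(u',v')$ if there exist walks $u_1\dots u_k$ and $v_1\dots v_k$ with $(u_1,v_1)=(u,v)$, $(u_k,v_k)=(u',v')$, all $(u_i,v_i)\in Z(G)$, and $(u_i,v_i)\Lambda(u_{i+1},v_{i+1})$ for each $i$. -}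

module Defs where

open import Data.Nat using (ℕ; zero; suc; _<_; _≤_)
open import Data.Fin using (Fin; zero; suc)
open import Data.Bool using (Bool; true; false; T)
open import Data.Product using (Σ; ∃; _×_; _,_)
open import Data.Sum using (_⊎_)
open import Relation.Nullary using (¬_)
open import Relation.Binary.PropositionalEquality using (_≡_; _≢_)
open import Function.Definitions using (Injective)

record Graph (n : ℕ) : Set where
  field
    adj     : Fin n → Fin n → Bool
    adj-sym : ∀ u v → adj u v ≡ adj v u
    adj-refl : ∀ u → adj u u ≡ true

module _ {n : ℕ} (G : Graph n) where
  open Graph G

  E : Fin n → Fin n → Set
  E u v = T (adj u v)

  -- Small pattern graphs on Fin 4
  -- C4 : 0-1-2-3-0 ;  P4 : 0-1-2-3 ;  2K2 : 0-1 , 2-3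
  -- Induced subgraph on the vertex set {a,b,c,d} isomorphic to the pattern H:
  -- an injective labelling f : Fin 4 → V whose image is exactly {a,b,c,d}
  -- and which preserves adjacency and non-adjacency between distinct vertices.
  Induces : (Fin 4 → Fin 4 → Bool) → Fin n → Fin n → Fin n → Fin n → Set
  Induces H a b c d =
    Σ (Fin 4 → Fin n) λ f →
      Injective _≡_ _≡_ f
      × (∀ i → (f i ≡ a ⊎ f i ≡ b ⊎ f i ≡ c ⊎ f i ≡ d))
      × (∃ λ i → f i ≡ a) × (∃ λ i → f i ≡ b)
      × (∃ λ i → f i ≡ c) × (∃ λ i → f i ≡ d)
      × (∀ i j → i ≢ j → (E (f i) (f j) → T (H i j)) × (T (H i j) → E (f i) (f j)))

C4pat : Fin 4 → Fin 4 → Bool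
C4pat zero (suc zero) = true
C4pat (suc zero) zero = true
C4pat (suc zero) (suc (suc zero)) = true
C4pat (suc (suc zero)) (suc zero) = true
C4pat (suc (suc zero)) (suc (suc (suc zero))) = true
C4pat (suc (suc (suc zero))) (suc (suc zero)) = true
C4pat (suc (suc (suc zero))) zero = true
C4pat zero (suc (suc (suc zero))) = true
C4pat _ _ = false

P4pat : Fin 4 → Fin 4 → Bool
P4pat zero (suc zero) = true
P4pat (suc zero) zero = true
P4pat (suc zero) (suc (suc zero)) = true
P4pat (suc (suc zero)) (suc zero) = true
P4pat (suc (suc zero)) (suc (suc (suc zero))) = true
P4pat (suc (suc (suc zero))) (suc (suc zero)) = true
P4pat _ _ = false

2K2pat : Fin 4 → Fin 4 → Bool
2K2pat zero (suc zero) = true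
2K2pat (suc zero) zero = true
2K2pat (suc (suc zero)) (suc (suc (suc zero))) = true
2K2pat (suc (suc (suc zero))) (suc (suc zero)) = true
2K2pat _ _ = false

module _ {n : ℕ} (G : Graph n) where

  InducesC4 : Fin n → Fin n → Fin n → Fin n → Set
  InducesC4 = Induces G C4pat

  Avoids : Fin n → Fin n → Fin n → Fin n → Set
  Avoids u u' v v' =
    (u ≢ v × u ≢ v' × u' ≢ v × u' ≢ v')
    × ( (u ≡ u' × v ≡ v' × ¬ E G u v)
      ⊎ (u ≡ u' × v ≢ v' × ¬ E G u v × ¬ E G u v')
      ⊎ (u ≢ u' × v ≡ v' × ¬ E G u v × ¬ E G u' v)
      ⊎ (u ≢ u' × v ≢ v' ×
           (Induces G 2K2pat u u' v v' ⊎ Induces G P4pat u u' v v' ⊎ Induces G C4pat u u' v v')))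

  -- w_0 … w_t is a walk (only the values w 0, …, w t matter)
  IsWalk : (ℕ → Fin n) → ℕ → Set
  IsWalk w t = ∀ j → j < t → E G (w j) (w (suc j))

  AvoidsWalk : Fin n → Fin n → (ℕ → Fin n) → ℕ → Set
  AvoidsWalk v v' w t = ∀ j → j < t → Avoids v v' (w j) (w (suc j))

  Forces : Fin n → Fin n → Fin n → Fin n → Set
  Forces u v u' v' =
    (u ≡ u' × v ≡ v')
    ⊎ (E G u u' × E G v v' × ¬ E G u v' × ¬ E G v u')

  -- (u , v) ∼ (u' , v'): sequences (p_0,q_0) … (p_k,q_k) (k ≥ 0 steps,
  -- i.e. k+1 pairs) with p, q walks, all pairs in Z(G), consecutive pairs forcing.
  Sim : Fin n → Fin n → Fin n → Fin n → Set
  Sim u v u' v' =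
    Σ ℕ λ k → Σ (ℕ → Fin n) λ p → Σ (ℕ → Fin n) λ q →
      p 0 ≡ u × q 0 ≡ v × p k ≡ u' × q k ≡ v'
      × IsWalk p k × IsWalk q k
      × (∀ i → i ≤ k → p i ≢ q i)
      × (∀ i → i < k → Forces (p i) (q i) (p (suc i)) (q (suc i)))

{-# OPTIONS --safe #-}
module Submission where

-- Avoidance of a walk edge w_j w_{j+1} by vv' yields three local facts: no vertex of
-- {w_j, w_{j+1}} is adjacent to both v and v', and no vertex of {v, v'} to both w_j and
-- w_{j+1} (the induced 2K2, P4 or C4 is triangle-free); and unless {w_j, w_{j+1}, v, v'}
-- induces a C4, some vertex of {v, v'} is adjacent to neither w_j nor w_{j+1} (2K2 and P4
-- contain no 4-cycle). From these one propagates along the walk the invariant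
-- (w_0, x) ∼ (w_{m+1}, b) for every b ∈ {v, v'} not adjacent to w_m: each forcing step
-- crosses a walk edge, preceded if necessary by a switch (u, a) Λ (u, b) along the loop at u.
-- The C4 hypotheses only decide whether the first and last pair may be chosen freely.

open import Defs
open import Data.Nat using (ℕ; zero; suc; _≤_; _<_; _∸_; s≤s; z≤n)
open import Data.Nat.Properties using (≤-refl; <⇒≤)
open import Data.Fin using (Fin; _≟_)
open import Data.Fin.Properties using (all?)
open import Data.Bool using (Bool; T)
open import Data.Unit using (tt)
open import Data.Empty using (⊥; ⊥-elim)
open import Data.Product using (Σ; ∃; _×_; _,_; proj₁)
open import Data.Sum using (_⊎_; inj₁; inj₂)
open import Function using (_∘_)
open import Relation.Nullary using (¬_; Dec; yes; no; ¬?)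
open import Relation.Nullary.Decidable using (T?; _→-dec_; from-yes)
open import Relation.Binary.PropositionalEquality using (_≡_; _≢_; refl; sym; subst; cong; ≢-sym)

Pattern : Set
Pattern = Fin 4 → Fin 4 → Bool

TriangleFree : Pattern → Set
TriangleFree H = ∀ i j k → T (H i j) → T (H j k) → ¬ T (H k i)

SquareFree : Pattern → Set
SquareFree H = ∀ i j k l → i ≢ k → j ≢ l → T (H i j) → T (H j k) → T (H k l) → ¬ T (H l i)

triangleFree? : ∀ H → Dec (TriangleFree H)
triangleFree? H = all? λ i → all? λ j → all? λ k →
  T? (H i j) →-dec T? (H j k) →-dec ¬? (T? (H k i))

squareFree? : ∀ H → Dec (SquareFree H)
squareFree? H = all? λ i → all? λ j → all? λ k → all? λ l →
  ¬? (i ≟ k) →-dec ¬? (j ≟ l) →-dec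
  T? (H i j) →-dec T? (H j k) →-dec T? (H k l) →-dec ¬? (T? (H l i))

C4-triangleFree : TriangleFree C4pat
C4-triangleFree = from-yes (triangleFree? C4pat)

P4-triangleFree : TriangleFree P4pat
P4-triangleFree = from-yes (triangleFree? P4pat)

2K2-triangleFree : TriangleFree 2K2pat
2K2-triangleFree = from-yes (triangleFree? 2K2pat)

P4-squareFree : SquareFree P4pat
P4-squareFree = from-yes (squareFree? P4pat)

2K2-squareFree : SquareFree 2K2pat
2K2-squareFree = from-yes (squareFree? 2K2pat)

_∈[_,_] : ∀ {n} → Fin n → Fin n → Fin n → Set
x ∈[ a , b ] = x ≡ a ⊎ x ≡ b

_∈⟨_,_,_,_⟩ : ∀ {n} → Fin n → Fin n → Fin n → Fin n → Fin n → Set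
x ∈⟨ a , b , c , d ⟩ = x ≡ a ⊎ x ≡ b ⊎ x ≡ c ⊎ x ≡ d

∈⟨⟩-left : ∀ {n} {x a a' b b' : Fin n} → x ∈[ a , a' ] → x ∈⟨ a , a' , b , b' ⟩
∈⟨⟩-left (inj₁ e) = inj₁ e
∈⟨⟩-left (inj₂ e) = inj₂ (inj₁ e)

∈⟨⟩-right : ∀ {n} {x a a' b b' : Fin n} → x ∈[ b , b' ] → x ∈⟨ a , a' , b , b' ⟩
∈⟨⟩-right (inj₁ e) = inj₂ (inj₂ (inj₁ e))
∈⟨⟩-right (inj₂ e) = inj₂ (inj₂ (inj₂ e))

∈⟨⟩-rotate : ∀ {n} {x a b c d : Fin n} → x ∈⟨ a , b , c , d ⟩ → x ∈⟨ c , d , a , b ⟩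
∈⟨⟩-rotate (inj₁ e)                = inj₂ (inj₂ (inj₁ e))
∈⟨⟩-rotate (inj₂ (inj₁ e))         = inj₂ (inj₂ (inj₂ e))
∈⟨⟩-rotate (inj₂ (inj₂ (inj₁ e)))  = inj₁ e
∈⟨⟩-rotate (inj₂ (inj₂ (inj₂ e)))  = inj₂ (inj₁ e)

∈[]-same : ∀ {n} {a c c' : Fin n} → c ∈[ a , a ] → c' ∈[ a , a ] → c ≡ c'
∈[]-same (inj₁ refl) (inj₁ refl) = refl
∈[]-same (inj₁ refl) (inj₂ refl) = refl
∈[]-same (inj₂ refl) (inj₁ refl) = refl
∈[]-same (inj₂ refl) (inj₂ refl) = refl

module Avoidance {n : ℕ} (G : Graph n) where
  open Graph G

  E-sym : ∀ {x y} → E G x y → E G y x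
  E-sym {x} {y} = subst T (adj-sym x y)

  E-refl : ∀ x → E G x x
  E-refl x = subst T (sym (adj-refl x)) tt

  E? : ∀ x y → Dec (E G x y)
  E? x y = T? (adj x y)

  ∈[]-adj : ∀ {a a' c c'} → E G a a' → c ∈[ a , a' ] → c' ∈[ a , a' ] → E G c c'
  ∈[]-adj aa' (inj₁ refl) (inj₁ refl) = E-refl _
  ∈[]-adj aa' (inj₁ refl) (inj₂ refl) = aa'
  ∈[]-adj aa' (inj₂ refl) (inj₁ refl) = E-sym aa'
  ∈[]-adj aa' (inj₂ refl) (inj₂ refl) = E-refl _

  label : ∀ {H a b c d x} (I : Induces G H a b c d) → x ∈⟨ a , b , c , d ⟩ → ∃ λ i → proj₁ I i ≡ x
  label (_ , _ , _ , ia , _ , _ , _ , _) (inj₁ refl)               = ia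
  label (_ , _ , _ , _ , ib , _ , _ , _) (inj₂ (inj₁ refl))        = ib
  label (_ , _ , _ , _ , _ , ic , _ , _) (inj₂ (inj₂ (inj₁ refl))) = ic
  label (_ , _ , _ , _ , _ , _ , id , _) (inj₂ (inj₂ (inj₂ refl))) = id

  label-adj : ∀ {H a b c d i j x y} (I : Induces G H a b c d) →
              proj₁ I i ≡ x → proj₁ I j ≡ y → x ≢ y → E G x y → T (H i j)
  label-adj {i = i} {j} (f , _ , _ , _ , _ , _ , _ , pres) refl refl x≢y =
    proj₁ (pres i j λ i≡j → x≢y (cong f i≡j))

  label-distinct : ∀ {H a b c d i j x y} (I : Induces G H a b c d) →
                   proj₁ I i ≡ x → proj₁ I j ≡ y → x ≢ y → i ≢ j
  label-distinct (f , _) refl refl x≢y i≡j = x≢y (cong f i≡j)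

  module _ {H a b c d} (I : Induces G H a b c d) where

    induced-triangle : TriangleFree H → ∀ {x y z} →
      x ∈⟨ a , b , c , d ⟩ → y ∈⟨ a , b , c , d ⟩ → z ∈⟨ a , b , c , d ⟩ →
      x ≢ y → y ≢ z → z ≢ x → E G x y → E G y z → ¬ E G z x
    induced-triangle tf x∈ y∈ z∈ x≢y y≢z z≢x xy yz zx
      with label I x∈ | label I y∈ | label I z∈
    ... | i , fi | j , fj | k , fk =
      tf i j k (label-adj I fi fj x≢y xy) (label-adj I fj fk y≢z yz) (label-adj I fk fi z≢x zx)

    induced-square : SquareFree H → ∀ {x y z u} →
      x ∈⟨ a , b , c , d ⟩ → y ∈⟨ a , b , c , d ⟩ → z ∈⟨ a , b , c , d ⟩ → u ∈⟨ a , b , c , d ⟩ →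
      x ≢ y → y ≢ z → z ≢ u → u ≢ x → x ≢ z → y ≢ u →
      E G x y → E G y z → E G z u → ¬ E G u x
    induced-square sf x∈ y∈ z∈ u∈ x≢y y≢z z≢u u≢x x≢z y≢u xy yz zu ux
      with label I x∈ | label I y∈ | label I z∈ | label I u∈
    ... | i , fi | j , fj | k , fk | l , fl =
      sf i j k l (label-distinct I fi fk x≢z) (label-distinct I fj fl y≢u)
         (label-adj I fi fj x≢y xy) (label-adj I fj fk y≢z yz) (label-adj I fk fl z≢u zu) (label-adj I fl fi u≢x ux)

  Induces-swap : ∀ {H a b c d} → Induces G H a b c d → Induces G H c d a b
  Induces-swap (f , inj , im , ia , ib , ic , id , pres) = f , inj , (λ i → ∈⟨⟩-rotate (im i)) , ic , id , ia , ib , pres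

  InducesAvoidPattern : Fin n → Fin n → Fin n → Fin n → Set
  InducesAvoidPattern a a' b b' =
    Induces G 2K2pat a a' b b' ⊎ Induces G P4pat a a' b b' ⊎ Induces G C4pat a a' b b'

  triangleFree-avoidance : ∀ {a a' b b'} → InducesAvoidPattern a a' b b' →
    Σ Pattern λ H → TriangleFree H × Induces G H a a' b b'
  triangleFree-avoidance (inj₁ I)        = 2K2pat , 2K2-triangleFree , I
  triangleFree-avoidance (inj₂ (inj₁ I)) = P4pat , P4-triangleFree , I
  triangleFree-avoidance (inj₂ (inj₂ I)) = C4pat , C4-triangleFree , I

  InducesAvoidPattern-swap : ∀ {a a' b b'} → InducesAvoidPattern a a' b b' → InducesAvoidPattern b b' a a'
  InducesAvoidPattern-swap (inj₁ I)        = inj₁ (Induces-swap I)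
  InducesAvoidPattern-swap (inj₂ (inj₁ I)) = inj₂ (inj₁ (Induces-swap I))
  InducesAvoidPattern-swap (inj₂ (inj₂ I)) = inj₂ (inj₂ (Induces-swap I))

  Avoids-sym : ∀ {a a' b b'} → Avoids G a a' b b' → Avoids G b b' a a'
  Avoids-sym {a} {a'} {b} {b'} ((ab , ab' , a'b , a'b') , cases) =
    (≢-sym ab , ≢-sym a'b , ≢-sym ab' , ≢-sym a'b') , flip cases
    where
      flip : (a ≡ a' × b ≡ b' × ¬ E G a b)
           ⊎ (a ≡ a' × b ≢ b' × ¬ E G a b × ¬ E G a b')
           ⊎ (a ≢ a' × b ≡ b' × ¬ E G a b × ¬ E G a' b)
           ⊎ (a ≢ a' × b ≢ b' × InducesAvoidPattern a a' b b')
           → (b ≡ b' × a ≡ a' × ¬ E G b a)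
           ⊎ (b ≡ b' × a ≢ a' × ¬ E G b a × ¬ E G b a')
           ⊎ (b ≢ b' × a ≡ a' × ¬ E G b a × ¬ E G b' a)
           ⊎ (b ≢ b' × a ≢ a' × InducesAvoidPattern b b' a a')
      flip (inj₁ (a≡a' , b≡b' , ¬ab)) = inj₁ (b≡b' , a≡a' , ¬ab ∘ E-sym)
      flip (inj₂ (inj₁ (a≡a' , b≢b' , ¬ab , ¬ab'))) = inj₂ (inj₂ (inj₁ (b≢b' , a≡a' , ¬ab ∘ E-sym , ¬ab' ∘ E-sym)))
      flip (inj₂ (inj₂ (inj₁ (a≢a' , b≡b' , ¬ab , ¬a'b)))) = inj₂ (inj₁ (b≡b' , a≢a' , ¬ab ∘ E-sym , ¬a'b ∘ E-sym))
      flip (inj₂ (inj₂ (inj₂ (a≢a' , b≢b' , I)))) = inj₂ (inj₂ (inj₂ (b≢b' , a≢a' , InducesAvoidPattern-swap I)))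

  avoids-distinct : ∀ {a a' b b' c x} → Avoids G a a' b b' → c ∈[ a , a' ] → x ∈[ b , b' ] → c ≢ x
  avoids-distinct ((ab , _ , _ , _) , _) (inj₁ refl) (inj₁ refl) = ab
  avoids-distinct ((_ , ab' , _ , _) , _) (inj₁ refl) (inj₂ refl) = ab'
  avoids-distinct ((_ , _ , a'b , _) , _) (inj₂ refl) (inj₁ refl) = a'b
  avoids-distinct ((_ , _ , _ , a'b') , _) (inj₂ refl) (inj₂ refl) = a'b'

  avoids-¬adj-both : ∀ {a a' b b' x} → E G a a' → Avoids G a a' b b' → x ∈[ b , b' ] → E G x a → ¬ E G x a'
  avoids-¬adj-both _ (_ , inj₁ (refl , refl , ¬ab)) (inj₁ refl) xa _ = ¬ab (E-sym xa)
  avoids-¬adj-both _ (_ , inj₁ (refl , refl , ¬ab)) (inj₂ refl) xa _ = ¬ab (E-sym xa)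
  avoids-¬adj-both _ (_ , inj₂ (inj₁ (refl , _ , ¬ab , _))) (inj₁ refl) xa _ = ¬ab (E-sym xa)
  avoids-¬adj-both _ (_ , inj₂ (inj₁ (refl , _ , _ , ¬ab'))) (inj₂ refl) xa _ = ¬ab' (E-sym xa)
  avoids-¬adj-both _ (_ , inj₂ (inj₂ (inj₁ (_ , refl , ¬ab , _)))) (inj₁ refl) xa _ = ¬ab (E-sym xa)
  avoids-¬adj-both _ (_ , inj₂ (inj₂ (inj₁ (_ , refl , ¬ab , _)))) (inj₂ refl) xa _ = ¬ab (E-sym xa)
  avoids-¬adj-both aa' av@(_ , inj₂ (inj₂ (inj₂ (a≢a' , _ , I)))) x∈ xa xa'
    with triangleFree-avoidance I
  ... | _ , tf , I′ =
    induced-triangle I′ tf (∈⟨⟩-right x∈) (∈⟨⟩-left (inj₁ refl)) (∈⟨⟩-left (inj₂ refl))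
      (≢-sym (avoids-distinct av (inj₁ refl) x∈)) a≢a' (avoids-distinct av (inj₂ refl) x∈)
      xa aa' (E-sym xa')

  squareFree-avoidance : ∀ {a a' b b'} → InducesAvoidPattern a a' b b' → ¬ InducesC4 G b b' a a' →
    Σ Pattern λ H → SquareFree H × Induces G H a a' b b'
  squareFree-avoidance (inj₁ I)        _   = 2K2pat , 2K2-squareFree , I
  squareFree-avoidance (inj₂ (inj₁ I)) _   = P4pat , P4-squareFree , I
  squareFree-avoidance (inj₂ (inj₂ I)) ¬C4 = ⊥-elim (¬C4 (Induces-swap I))

  avoids-¬matching : ∀ {a a' b b' c c'} → E G a a' → E G b b' → Avoids G a a' b b' →
    ¬ InducesC4 G b b' a a' → c ∈[ a , a' ] → c' ∈[ a , a' ] → c ≢ c' → E G b c → ¬ E G b' c'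
  avoids-¬matching _ _ (_ , inj₁ (refl , _)) _ c∈ c'∈ c≢c' _ _ = c≢c' (∈[]-same c∈ c'∈)
  avoids-¬matching _ _ (_ , inj₂ (inj₁ (refl , _))) _ c∈ c'∈ c≢c' _ _ = c≢c' (∈[]-same c∈ c'∈)
  avoids-¬matching _ _ (_ , inj₂ (inj₂ (inj₁ (_ , _ , ¬ab , _)))) _ (inj₁ refl) _ _ bc _ = ¬ab (E-sym bc)
  avoids-¬matching _ _ (_ , inj₂ (inj₂ (inj₁ (_ , _ , _ , ¬a'b)))) _ (inj₂ refl) _ _ bc _ = ¬a'b (E-sym bc)
  avoids-¬matching aa' bb' av@(_ , inj₂ (inj₂ (inj₂ (_ , b≢b' , I)))) ¬C4 c∈ c'∈ c≢c' bc b'c'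
    with squareFree-avoidance I ¬C4
  ... | _ , sf , I′ =
    induced-square I′ sf (∈⟨⟩-right (inj₁ refl)) (∈⟨⟩-left c∈) (∈⟨⟩-left c'∈) (∈⟨⟩-right (inj₂ refl))
      (≢-sym (avoids-distinct av c∈ (inj₁ refl))) c≢c' (avoids-distinct av c'∈ (inj₂ refl)) (≢-sym b≢b')
      (≢-sym (avoids-distinct av c'∈ (inj₁ refl))) (avoids-distinct av c∈ (inj₂ refl))
      bc (∈[]-adj aa' c∈ c'∈) (E-sym b'c') (E-sym bb')

  data CommonOrCrossed (a a' p q : Fin n) : Set where
    common  : ∀ {c} → c ∈[ a , a' ] → ¬ E G p c → ¬ E G q c → CommonOrCrossed a a' p q
    crossed : ∀ {c c'} → c ∈[ a , a' ] → c' ∈[ a , a' ] →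
              E G p c → ¬ E G p c' → E G q c' → ¬ E G q c → CommonOrCrossed a a' p q

  commonOrCrossed : ∀ {a a' p q} → (E G p a → ¬ E G p a') → (E G q a → ¬ E G q a') → CommonOrCrossed a a' p q
  commonOrCrossed {a} {a'} {p} {q} p¬both q¬both = go (E? p a) (E? q a) (E? p a') (E? q a')
    where
      go : Dec (E G p a) → Dec (E G q a) → Dec (E G p a') → Dec (E G q a') → CommonOrCrossed a a' p q
      go (no ¬pa) (no ¬qa) _ _ = common (inj₁ refl) ¬pa ¬qa
      go _ _ (no ¬pa') (no ¬qa') = common (inj₂ refl) ¬pa' ¬qa'
      go (yes pa) _ _ (yes qa') = crossed (inj₁ refl) (inj₂ refl) pa (p¬both pa) qa' (λ qa → q¬both qa qa')
      go _ (yes qa) (yes pa') _ = crossed (inj₂ refl) (inj₁ refl) pa' (λ pa → p¬both pa pa') qa (q¬both qa)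
      go (yes pa) (no _) (yes pa') (no _) = ⊥-elim (p¬both pa pa')
      go (no _) (yes qa) (no _) (yes qa') = ⊥-elim (q¬both qa qa')

module Forcing {n : ℕ} (G : Graph n) where

  data Chain : Fin n → Fin n → Fin n → Fin n → Set where
    stay  : ∀ {p q} → p ≢ q → Chain p q p q
    force : ∀ {p q p' q' r s} → p ≢ q → E G p p' → E G q q' → ¬ E G p q' → ¬ E G q p' →
            Chain p' q' r s → Chain p q r s

  force₁ : ∀ {p q p' q'} → p ≢ q → p' ≢ q' → E G p p' → E G q q' → ¬ E G p q' → ¬ E G q p' → Chain p q p' q'
  force₁ p≢q p'≢q' pp' qq' ¬pq' ¬qp' = force p≢q pp' qq' ¬pq' ¬qp' (stay p'≢q')

  infixr 5 _++_
  _++_ : ∀ {p q r s r' s'} → Chain p q r s → Chain r s r' s' → Chain p q r' s'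
  stay _ ++ C' = C'
  force p≢q pp' qq' ¬pq' ¬qp' C ++ C' = force p≢q pp' qq' ¬pq' ¬qp' (C ++ C')

  _◃_ : Fin n → (ℕ → Fin n) → ℕ → Fin n
  (x ◃ f) zero    = x
  (x ◃ f) (suc i) = f i

  Sim-refl : ∀ {p q} → p ≢ q → Sim G p q p q
  Sim-refl {p} {q} p≢q =
    0 , (λ _ → p) , (λ _ → q) , refl , refl , refl , refl , (λ _ ()) , (λ _ ()) , (λ _ _ → p≢q) , (λ _ ())

  Sim-force : ∀ {p q p' q' r s} → p ≢ q → E G p p' → E G q q' → ¬ E G p q' → ¬ E G q p' →
              Sim G p' q' r s → Sim G p q r s
  Sim-force {p} {q} p≢q pp' qq' ¬pq' ¬qp' (k , P , Q , refl , refl , Pk , Qk , walkP , walkQ , distinct , forces) =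
    suc k , p ◃ P , q ◃ Q , refl , refl , Pk , Qk , walkP′ , walkQ′ , distinct′ , forces′
    where
      walkP′ : IsWalk G (p ◃ P) (suc k)
      walkP′ zero    _       = pp'
      walkP′ (suc j) (s≤s j<k) = walkP j j<k
      walkQ′ : IsWalk G (q ◃ Q) (suc k)
      walkQ′ zero    _       = qq'
      walkQ′ (suc j) (s≤s j<k) = walkQ j j<k
      distinct′ : ∀ i → i ≤ suc k → (p ◃ P) i ≢ (q ◃ Q) i
      distinct′ zero    _         = p≢q
      distinct′ (suc i) (s≤s i≤k) = distinct i i≤k
      forces′ : ∀ i → i < suc k → Forces G ((p ◃ P) i) ((q ◃ Q) i) ((p ◃ P) (suc i)) ((q ◃ Q) (suc i))
      forces′ zero    _         = inj₂ (pp' , qq' , ¬pq' , ¬qp')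
      forces′ (suc i) (s≤s i<k) = forces i i<k

  Chain⇒Sim : ∀ {p q r s} → Chain p q r s → Sim G p q r s
  Chain⇒Sim (stay p≢q)                        = Sim-refl p≢q
  Chain⇒Sim (force p≢q pp' qq' ¬pq' ¬qp' C) = Sim-force p≢q pp' qq' ¬pq' ¬qp' (Chain⇒Sim C)

module Walk {n : ℕ} (G : Graph n) {v v' : Fin n} (vv' : E G v v') (w : ℕ → Fin n) (t : ℕ)
            (walk : IsWalk G w t) (avoid : AvoidsWalk G v v' w t) where

  open Avoidance G
  open Forcing G

  walk-distinct : ∀ {j x c} → j < t → x ∈[ w j , w (suc j) ] → c ∈[ v , v' ] → x ≢ c
  walk-distinct j<t x∈ c∈ = ≢-sym (avoids-distinct (avoid _ j<t) c∈ x∈)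

  walk-¬adj-both : ∀ {j x} → j < t → x ∈[ w j , w (suc j) ] → E G x v → ¬ E G x v'
  walk-¬adj-both j<t = avoids-¬adj-both vv' (avoid _ j<t)

  endpoint-¬adj-both : ∀ {j c} → j < t → c ∈[ v , v' ] → E G c (w j) → ¬ E G c (w (suc j))
  endpoint-¬adj-both j<t = avoids-¬adj-both (walk _ j<t) (Avoids-sym (avoid _ j<t))

  commonNonNeighbour : ∀ {j} → j < t → ¬ InducesC4 G (w j) (w (suc j)) v v' →
    ∃ λ c → c ∈[ v , v' ] × ¬ E G (w j) c × ¬ E G (w (suc j)) c
  commonNonNeighbour j<t ¬C4
    with commonOrCrossed (walk-¬adj-both j<t (inj₁ refl)) (walk-¬adj-both j<t (inj₂ refl))
  ... | common c∈ ¬pc ¬qc = _ , c∈ , ¬pc , ¬qc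
  ... | crossed c∈ c'∈ pc ¬pc' qc' _ =
    ⊥-elim (avoids-¬matching vv' (walk _ j<t) (avoid _ j<t) ¬C4 c∈ c'∈ (λ { refl → ¬pc' pc }) pc qc')

  cross : ∀ {j a b} → j < t → a ∈[ v , v' ] → b ∈[ v , v' ] →
          ¬ E G (w j) b → ¬ E G a (w (suc j)) → Chain (w j) a (w (suc j)) b
  cross j<t a∈ b∈ =
    force₁ (walk-distinct j<t (inj₁ refl) a∈) (walk-distinct j<t (inj₂ refl) b∈) (walk _ j<t) (∈[]-adj vv' a∈ b∈)

  switch : ∀ {j x a b} → j < t → x ∈[ w j , w (suc j) ] → a ∈[ v , v' ] → b ∈[ v , v' ] →
           ¬ E G x b → ¬ E G a x → Chain x a x b
  switch j<t x∈ a∈ b∈ =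
    force₁ (walk-distinct j<t x∈ a∈) (walk-distinct j<t x∈ b∈) (E-refl _) (∈[]-adj vv' a∈ b∈)

  Reaches : Fin n → ℕ → Set
  Reaches x m = ∀ {b} → b ∈[ v , v' ] → ¬ E G (w m) b → Chain (w 0) x (w (suc m)) b

  reaches-start : ∀ {x} → 0 < t → x ∈[ v , v' ] → ¬ E G x (w 1) → Reaches x 0
  reaches-start 0<t x∈ ¬xw₁ b∈ ¬w₀b = cross 0<t x∈ b∈ ¬w₀b ¬xw₁

  reaches-step : ∀ {x m} → suc m < t → Reaches x m → Reaches x (suc m)
  reaches-step {m = m} sm<t R b∈ ¬w₁b
    with commonOrCrossed (walk-¬adj-both (<⇒≤ sm<t) (inj₁ refl)) (walk-¬adj-both sm<t (inj₂ refl))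
  ... | common a∈ ¬w₀a ¬w₂a =
    R a∈ ¬w₀a ++ cross sm<t a∈ b∈ ¬w₁b (¬w₂a ∘ E-sym)
  ... | crossed {a} {a'} a∈ a'∈ w₀a ¬w₀a' w₂a' ¬w₂a =
    R a'∈ ¬w₀a' ++ switch sm<t (inj₁ refl) a'∈ a∈ ¬w₁a ¬a'w₁ ++ cross sm<t a∈ b∈ ¬w₁b (¬w₂a ∘ E-sym)
    where
      ¬w₁a : ¬ E G (w (suc m)) a
      ¬w₁a = endpoint-¬adj-both (<⇒≤ sm<t) a∈ (E-sym w₀a) ∘ E-sym
      ¬a'w₁ : ¬ E G a' (w (suc m))
      ¬a'w₁ a'w₁ = endpoint-¬adj-both sm<t a'∈ a'w₁ (E-sym w₂a')

  reaches : ∀ {x} → Reaches x 0 → ∀ m → m < t → Reaches x m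
  reaches R zero    _    = R
  reaches R (suc m) sm<t = reaches-step sm<t (reaches R m (<⇒≤ sm<t))

  reaches-from-neighbour : ∀ {x} → 0 < t → x ∈[ v , v' ] → E G (w 0) x → Reaches x 0
  reaches-from-neighbour 0<t x∈ w₀x = reaches-start 0<t x∈ (endpoint-¬adj-both 0<t x∈ (E-sym w₀x))

  reaches-from-¬C4 : ∀ {x} → 0 < t → ¬ InducesC4 G (w 0) (w 1) v v' → x ∈[ v , v' ] → Reaches x 0
  reaches-from-¬C4 {x} 0<t ¬C4 x∈ with E? x (w 1) | commonNonNeighbour 0<t ¬C4
  ... | no ¬xw₁ | _ = reaches-start 0<t x∈ ¬xw₁
  ... | yes xw₁ | a , a∈ , ¬w₀a , ¬w₁a = λ b∈ ¬w₀b →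
    switch 0<t (inj₁ refl) x∈ a∈ ¬w₀a (λ xw₀ → endpoint-¬adj-both 0<t x∈ xw₀ xw₁)
      ++ reaches-start 0<t a∈ (¬w₁a ∘ E-sym) b∈ ¬w₀b

  finish-¬C4 : ∀ {x y m} → m < t → ¬ InducesC4 G (w m) (w (suc m)) v v' → Reaches x m →
               y ∈[ v , v' ] → Chain (w 0) x (w (suc m)) y
  finish-¬C4 {y = y} {m} m<t ¬C4 R y∈ with E? (w m) y | commonNonNeighbour m<t ¬C4
  ... | no ¬wₘy | _ = R y∈ ¬wₘy
  ... | yes wₘy | a , a∈ , ¬wₘa , ¬wₜa =
    R a∈ ¬wₘa ++ switch m<t (inj₂ refl) a∈ y∈ (endpoint-¬adj-both m<t y∈ (E-sym wₘy) ∘ E-sym) (¬wₜa ∘ E-sym)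

  finish-neighbour : ∀ {x y m} → m < t → Reaches x m → y ∈[ v , v' ] → E G (w (suc m)) y →
                     Chain (w 0) x (w (suc m)) y
  finish-neighbour m<t R y∈ wₜy = R y∈ λ wₘy → endpoint-¬adj-both m<t y∈ (E-sym wₘy) (E-sym wₜy)

lemma5 : ∀ {n} (G : Graph n) (v v' : Fin n) (w : ℕ → Fin n) (t : ℕ) →
    1 ≤ t → E G v v' → IsWalk G w t → AvoidsWalk G v v' w t →
    (¬ InducesC4 G (w 0) (w 1) v v' → ¬ InducesC4 G (w (t ∸ 1)) (w t) v v' →
      ∀ x y → (x ≡ v ⊎ x ≡ v') → (y ≡ v ⊎ y ≡ v') → Sim G (w 0) x (w t) y)
    × (InducesC4 G (w 0) (w 1) v v' → ¬ InducesC4 G (w (t ∸ 1)) (w t) v v' →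
      ∀ x y → (x ≡ v ⊎ x ≡ v') → E G (w 0) x → (y ≡ v ⊎ y ≡ v') → Sim G (w 0) x (w t) y)
    × (InducesC4 G (w 0) (w 1) v v' → InducesC4 G (w (t ∸ 1)) (w t) v v' →
      ∀ x y → (x ≡ v ⊎ x ≡ v') → E G (w 0) x → (y ≡ v ⊎ y ≡ v') → E G (w t) y →
      Sim G (w 0) x (w t) y)
lemma5 G v v' w (suc m) (s≤s z≤n) vv' walk avoid =
    (λ ¬C4₀ ¬C4ₜ _ _ x∈ y∈ → Chain⇒Sim (finish-¬C4 last ¬C4ₜ (reachesᵗ (reaches-from-¬C4 0<t ¬C4₀ x∈)) y∈))
  , (λ _ ¬C4ₜ _ _ x∈ w₀x y∈ → Chain⇒Sim (finish-¬C4 last ¬C4ₜ (reachesᵗ (reaches-from-neighbour 0<t x∈ w₀x)) y∈))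
  , (λ _ _ _ _ x∈ w₀x y∈ wₜy → Chain⇒Sim (finish-neighbour last (reachesᵗ (reaches-from-neighbour 0<t x∈ w₀x)) y∈ wₜy))
  where
    open Forcing G using (Chain⇒Sim)
    open Walk G vv' w (suc m) walk avoid
    0<t : 0 < suc m
    0<t = s≤s z≤n
    last : m < suc m
    last = ≤-refl
    reachesᵗ : ∀ {x} → Reaches x 0 → Reaches x m
    reachesᵗ R = reaches R m last
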